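{- Let $G$ be a graph containing no member of $\mathcal{H}=\{C_6,C_6^1,C_6^2,C_6^3\}$ as an induced subgraph. If $k(H^*)=\alpha(H^*)$ for every induced subgraph $H$ of $G$, then $G$ is cd-perfect. Consequently, if $G$ contains no member of $\mathcal{H}$ as an induced subgraph and $H^*$ is perfect for every induced subgraph $H$ of $G$, then $G$ is cd-perfect.
   Context: Graphs are finite, simple, undirected. $C_6$ is the $6$-cycle with bipartition into independent sets of size $3$; $C_6^1,C_6^2,C_6^3$ are obtained from $C_6$ by adding respectively $1,2,3$ edges among the vertices of one of the two parts. For a graph $H$, the auxiliary graph $H^*$ has vertex set $V(H)$ and edge set $\{uv:d_H(u,v)=2\}$. $\alpha$ is the independence number, $k$ the clique cover number. A cd-colouring of $H$ is a proper colouring in which every colour class $C$ satisfies $C\subseteq N_H[v]$ for some vertex $v$ (i.e. $C\subseteq N_H(v)$ when $|C|\ge 2$; singleton classes always allowed); $\chi_{cd}(H)$ is its minimum number of colours. A separated-cluster of $H$ is a set of vertices no two at distance exactly $2$ in $H$; $\omega_s(H)$ is the maximum size of one. $G$ is cd-perfect if $\chi_{cd}(H)=\omega_s(H)$ for every induced subgraph $H$ of $G$. -}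

module Defs where

open import Data.Nat using (ℕ; zero; suc; _≤_; _≡ᵇ_)
open import Data.Fin using (Fin; toℕ)
open import Data.Bool using (Bool; true; false; _∧_; _∨_)
open import Data.List using (List; []; _∷_)
open import Data.Product using (Σ; ∃; ∃-syntax; _×_; _,_)
open import Data.Sum using (_⊎_; inj₁; inj₂)
open import Relation.Nullary using (¬_)
open import Relation.Binary.PropositionalEquality using (_≡_; _≢_)
open import Function.Definitions using (Injective)
open import Function.Bundles using (_⇔_)

record Graph (n : ℕ) : Set₁ where
  field
    Adj    : Fin n → Fin n → Set
    sym    : ∀ {u v} → Adj u v → Adj v u
    irrefl : ∀ {u} → ¬ Adj u u
open Graph public

-- The subgraph induced on the image of an injective map f : Fin m → Fin n.
-- Every induced subgraph of G is (isomorphic to) one of these.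
induce : ∀ {n m} → Graph n → (f : Fin m → Fin n) → Graph m
induce G f = record
  { Adj    = λ i j → Adj G (f i) (f j)
  ; sym    = sym G
  ; irrefl = irrefl G }

Dist2 : ∀ {n} → Graph n → Fin n → Fin n → Set
Dist2 H u v = (u ≢ v) × (¬ Adj H u v) × (∃[ w ] (Adj H u w × Adj H w v))

star : ∀ {n} → Graph n → Graph n
star H = record
  { Adj    = Dist2 H
  ; sym    = λ { (u≢v , ¬a , w , a₁ , a₂) →
               (λ e → u≢v (symm e)) , (λ a → ¬a (sym H a)) , w , sym H a₂ , sym H a₁ }
  ; irrefl = λ { (u≢u , _) → u≢u Relation.Binary.PropositionalEquality.refl } }
  where
  symm = Relation.Binary.PropositionalEquality.sym

ContainsInduced : ∀ {n} → Graph n → (Fin 6 → Fin 6 → Set) → Set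
ContainsInduced G E =
  ∃[ f ] (Injective _≡_ _≡_ f × (∀ i j → Adj G (f i) (f j) ⇔ E i j))

isEdge : List (ℕ × ℕ) → ℕ → ℕ → Bool
isEdge [] a b = false
isEdge ((x , y) ∷ es) a b =
  (((x ≡ᵇ a) ∧ (y ≡ᵇ b)) ∨ ((x ≡ᵇ b) ∧ (y ≡ᵇ a))) ∨ isEdge es a b

fromEdges : List (ℕ × ℕ) → Fin 6 → Fin 6 → Set
fromEdges es i j = isEdge es (toℕ i) (toℕ j) ≡ true

-- C6 : 0-1-2-3-4-5-0, parts {0,2,4} and {1,3,5}
c6Edges : List (ℕ × ℕ)
c6Edges = (0 , 1) ∷ (1 , 2) ∷ (2 , 3) ∷ (3 , 4) ∷ (4 , 5) ∷ (5 , 0) ∷ []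

C6 C6¹ C6² C6³ : Fin 6 → Fin 6 → Set
C6  = fromEdges c6Edges
C6¹ = fromEdges ((0 , 2) ∷ c6Edges)
C6² = fromEdges ((0 , 2) ∷ (2 , 4) ∷ c6Edges)
C6³ = fromEdges ((0 , 2) ∷ (2 , 4) ∷ (0 , 4) ∷ c6Edges)

ℋ-free : ∀ {n} → Graph n → Set
ℋ-free G = ¬ ContainsInduced G C6 × ¬ ContainsInduced G C6¹
         × ¬ ContainsInduced G C6² × ¬ ContainsInduced G C6³

-- Parameters, each given as "k is the min/max" (a functional relation)

IsCliqueCover : ∀ {n} → Graph n → (k : ℕ) → (Fin n → Fin k) → Set
IsCliqueCover H k c = ∀ u v → c u ≡ c v → u ≢ v → Adj H u v

IsCliqueCoverNumber : ∀ {n} → Graph n → ℕ → Set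
IsCliqueCoverNumber H k =
  (∃[ c ] IsCliqueCover H k c) × (∀ j (c : _) → IsCliqueCover H j c → k ≤ j)

IsIndependent : ∀ {n} → Graph n → (j : ℕ) → (Fin j → Fin n) → Set
IsIndependent H j g = Injective _≡_ _≡_ g × (∀ a b → ¬ Adj H (g a) (g b))

IsIndependenceNumber : ∀ {n} → Graph n → ℕ → Set
IsIndependenceNumber H k =
  (∃[ g ] IsIndependent H k g) × (∀ j (g : _) → IsIndependent H j g → j ≤ k)

IsProper : ∀ {n} → Graph n → (k : ℕ) → (Fin n → Fin k) → Set
IsProper H k c = ∀ u v → Adj H u v → c u ≢ c v

IsChromaticNumber : ∀ {n} → Graph n → ℕ → Set
IsChromaticNumber H k =
  (∃[ c ] IsProper H k c) × (∀ j (c : _) → IsProper H j c → k ≤ j)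

IsClique : ∀ {n} → Graph n → (j : ℕ) → (Fin j → Fin n) → Set
IsClique H j g = Injective _≡_ _≡_ g × (∀ a b → a ≢ b → Adj H (g a) (g b))

IsCliqueNumber : ∀ {n} → Graph n → ℕ → Set
IsCliqueNumber H k =
  (∃[ g ] IsClique H k g) × (∀ j (g : _) → IsClique H j g → j ≤ k)

Perfect : ∀ {n} → Graph n → Set
Perfect G = ∀ m (f : Fin m → _) → Injective _≡_ _≡_ f →
  ∃[ k ] (IsChromaticNumber (induce G f) k × IsCliqueNumber (induce G f) k)

IsCdColouring : ∀ {n} → Graph n → (k : ℕ) → (Fin n → Fin k) → Set
IsCdColouring H k c = IsProper H k c ×
  (∀ (i : Fin k) → ∃[ v ] (∀ u → c u ≡ i → (u ≡ v ⊎ Adj H v u)))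

IsChiCd : ∀ {n} → Graph n → ℕ → Set
IsChiCd H k =
  (∃[ c ] IsCdColouring H k c) × (∀ j (c : _) → IsCdColouring H j c → k ≤ j)

IsSeparatedCluster : ∀ {n} → Graph n → (j : ℕ) → (Fin j → Fin n) → Set
IsSeparatedCluster H j g = Injective _≡_ _≡_ g × (∀ a b → ¬ Dist2 H (g a) (g b))

IsOmegaS : ∀ {n} → Graph n → ℕ → Set
IsOmegaS H k =
  (∃[ g ] IsSeparatedCluster H k g) × (∀ j (g : _) → IsSeparatedCluster H j g → j ≤ k)

CdPerfect : ∀ {n} → Graph n → Set
CdPerfect G = ∀ m (f : Fin m → _) → Injective _≡_ _≡_ f →
  ∃[ k ] (IsChiCd (induce G f) k × IsOmegaS (induce G f) k)

{-# OPTIONS --safe #-}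
module Submission where

-- A class of a cd-colouring of H lies in some N(v), so its vertices are pairwise at distance 2:
-- it is a clique of H*.  Separated-clusters of H are literally the independent sets of H*.  Hence
-- χ_cd(H) ≥ k(H*) and ω_s(H) = α(H*), and it remains to see that in an ℋ-free graph every clique of
-- H* has a common neighbour, so that minimum clique covers of H* are cd-colourings.  This is a
-- Helly property, proved by induction: for a, b, d pairwise at distance 2 (and further vertices),
-- let w_a, w_b, w_d be common neighbours of all vertices but a, b, d respectively.  One of them is
-- a common neighbour of all, for if w_a ≁ a, w_b ≁ b and w_d ≁ d, then w_b a w_d b w_a d is a
-- 6-cycle whose only chords join w's, i.e. an induced member of ℋ.
--
-- For the second statement, perfection of H* gives k(H*) = α(H*) by Lovász's weak perfect graph
-- theorem, proved by his argument: the replication lemma shows that some clique K meets every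
-- maximum stable set, so α(H* − K) < α(H*), and α(H* − K) cliques covering H* − K together with
-- K cover H*.

open import Defs
open import Data.Nat using (ℕ; zero; suc; _≤_; _<_; _*_; _+_; z≤n; s≤s)
import Data.Nat.Properties as ℕ
open import Data.Bool using (Bool; true; false; _∨_)
import Data.Bool as Bool
open import Data.Fin using (Fin; zero; suc; toℕ; fromℕ<; inject≤)
import Data.Fin as Fin
import Data.Fin.Properties as Fin
open import Data.Fin.Properties using (injective⇒≤; toℕ-fromℕ<; toℕ-injective; inject≤-injective; toℕ<n)
open import Data.Fin.Patterns using (0F; 1F; 2F; 3F; 4F; 5F)
open import Data.List using (List; []; _∷_; length; filter; map; lookup; allFin; upTo; _++_)
open import Data.List.Properties using (filter-notAll; length-map; length-++; length-upTo; length-tabulate)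
open import Data.List.Extrema.Nat using (argmax; argmax-all; f[xs]≤f[argmax])
open import Data.List.Relation.Unary.All as All using (All; []; _∷_)
import Data.List.Relation.Unary.All.Properties as All
open import Data.List.Relation.Unary.Any as Any using (Any; here; there)
open import Data.List.Relation.Unary.Any.Properties using (lookup-index)
open import Data.List.Relation.Unary.AllPairs as AllPairs using (AllPairs; []; _∷_)
import Data.List.Relation.Unary.AllPairs.Properties as AllPairs
open import Data.List.Relation.Unary.Unique.Propositional using (Unique)
import Data.List.Relation.Unary.Unique.Propositional.Properties as Unique
open import Data.List.Membership.Propositional using (_∈_; find; lose)
open import Data.List.Membership.Propositional.Properties
  using (∈-lookup; ∈-allFin; ∈-filter⁺; ∈-filter⁻; ∈-map⁺; ∈-map⁻; ∈-upTo⁺; ∈-++⁺ˡ; ∈-++⁺ʳ; ∈-++⁻)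
open import Data.List.Relation.Binary.Subset.Propositional using (_⊆_)
import Data.List.Relation.Binary.Subset.Propositional.Properties as Subset
open import Data.Product using (_×_; _,_; proj₁; proj₂; ∃-syntax)
import Data.Product.Properties as Product
open import Data.Sum using (_⊎_; inj₁; inj₂; [_,_])
open import Data.Empty using (⊥; ⊥-elim)
open import Relation.Nullary using (¬_; Dec; yes; no; ¬?; _×-dec_; _⊎-dec_; _→-dec_)
open import Relation.Nullary.Reflects using (Reflects; ofʸ; ofⁿ; det)
open import Relation.Nullary.Decidable using (True; toWitness; proof; ¬¬-excluded-middle; decidable-stable)
open import Relation.Unary using (Decidable)
open import Relation.Unary.Properties using (∁?)
open import Relation.Binary using (Symmetric; DecidableEquality)
open import Relation.Binary.PropositionalEquality as ≡ using (_≡_; _≢_; refl; cong; cong₂)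
open import Function using (_∘_)
open import Function.Definitions using (Injective)
open import Function.Bundles using (_⇔_; mk⇔)

module _ {A : Set} where

  lookup-injective : ∀ {xs : List A} → Unique xs → Injective _≡_ _≡_ (lookup xs)
  lookup-injective {_ ∷ _} (_ ∷ _)     {zero}  {zero}  _ = refl
  lookup-injective {_ ∷ _} (x∉ ∷ _)    {zero}  {suc j} e = ⊥-elim (All.lookup x∉ (∈-lookup j) e)
  lookup-injective {_ ∷ _} (x∉ ∷ _)    {suc i} {zero}  e = ⊥-elim (All.lookup x∉ (∈-lookup i) (≡.sym e))
  lookup-injective {_ ∷ _} (_ ∷ uniq)  {suc i} {suc j} e = cong suc (lookup-injective uniq e)

  ⊆-length : ∀ {xs ys : List A} → Unique xs → xs ⊆ ys → length xs ≤ length ys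
  ⊆-length {xs} {ys} uniq xs⊆ys = injective⇒≤ position-injective
    where
    position : Fin (length xs) → Fin (length ys)
    position i = Any.index (xs⊆ys (∈-lookup i))

    position-injective : Injective _≡_ _≡_ position
    position-injective {i} {j} e = lookup-injective uniq (begin
      lookup xs i                  ≡⟨ lookup-index (xs⊆ys (∈-lookup i)) ⟩
      lookup ys (position i)       ≡⟨ cong (lookup ys) e ⟩
      lookup ys (position j)       ≡⟨ lookup-index (xs⊆ys (∈-lookup j)) ⟨
      lookup xs j                  ∎)
      where open ≡.≡-Reasoning

  AllPairs-∈ : ∀ {R : A → A → Set} → Symmetric R → ∀ {xs} → AllPairs R xs →
               ∀ {x y} → x ∈ xs → y ∈ xs → x ≢ y → R x y
  AllPairs-∈ sym (_ ∷ _)   (here refl) (here refl) x≢y = ⊥-elim (x≢y refl)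
  AllPairs-∈ sym (rx ∷ _)  (here refl) (there y∈)  _   = All.lookup rx y∈
  AllPairs-∈ sym (rx ∷ _)  (there x∈)  (here refl) _   = sym (All.lookup rx x∈)
  AllPairs-∈ sym (_ ∷ rxs) (there x∈)  (there y∈)  x≢y = AllPairs-∈ sym rxs x∈ y∈ x≢y

  AllPairs-from-∈ : ∀ {R : A → A → Set} {xs} → Unique xs →
                    (∀ {x y} → x ∈ xs → y ∈ xs → x ≢ y → R x y) → AllPairs R xs
  AllPairs-from-∈ []         r = []
  AllPairs-from-∈ (x∉ ∷ uniq) r =
    All.tabulate (λ y∈ → r (here refl) (there y∈) (All.lookup x∉ y∈))
    ∷ AllPairs-from-∈ uniq (λ x∈ y∈ → r (there x∈) (there y∈))

unique-below-length : ∀ {ns : List ℕ} k → Unique ns → All (_< k) ns → length ns ≤ k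
unique-below-length {ns} k uniq below =
  ℕ.≤-trans (⊆-length uniq (∈-upTo⁺ ∘ All.lookup below)) (ℕ.≤-reflexive (length-upTo k))

unique-below-surjective : ∀ {ns : List ℕ} k → Unique ns → All (_< k) ns → k ≤ length ns →
                    ∀ {y} → y < k → y ∈ ns
unique-below-surjective {ns} k uniq below k≤ {y} y<k with Any.any? (y ℕ.≟_) ns
... | yes y∈ = y∈
... | no y∉ = ⊥-elim (ℕ.<-irrefl refl (ℕ.≤-trans too-long k≤))
  where
  too-long : suc (length ns) ≤ k
  too-long = unique-below-length k (All.tabulate (λ z∈ y≡z → y∉ (≡.subst (_∈ ns) (≡.sym y≡z) z∈)) ∷ uniq) (y<k ∷ below)

module _ {A : Set} where

  length-filter-∁ : ∀ {P : A → Set} (P? : Decidable P) xs →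
                    length xs ≡ length (filter P? xs) + length (filter (∁? P?) xs)
  length-filter-∁ P? [] = refl
  length-filter-∁ P? (x ∷ xs) with P? x
  ... | yes _ = cong suc (length-filter-∁ P? xs)
  ... | no _  = ≡.trans (cong suc (length-filter-∁ P? xs)) (≡.sym (ℕ.+-suc _ _))

  length-≤-classes : ∀ (c : A → ℕ) a k xs → Unique xs → All (λ x → c x < k) xs →
                     (∀ i ys → Unique ys → ys ⊆ xs → All (λ y → c y ≡ i) ys → length ys ≤ a) →
                     length xs ≤ k * a
  length-≤-classes c a zero [] _ _ _ = z≤n
  length-≤-classes c a zero (x ∷ xs) _ (() ∷ _) _
  length-≤-classes c a (suc k) xs uniq below classes = begin
    length xs                                    ≡⟨ length-filter-∁ P? xs ⟩
    length (filter P? xs) + length (filter (∁? P?) xs)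
      ≤⟨ ℕ.+-mono-≤ (classes k _ (Unique.filter⁺ P? uniq) (Subset.filter-⊆ P? xs)
                                 (All.tabulate (proj₂ ∘ ∈-filter⁻ P? {xs = xs})))
                  (length-≤-classes c a k _ (Unique.filter⁺ (∁? P?) uniq) below′
                     (λ i ys u ys⊆ → classes i ys u (Subset.filter-⊆ (∁? P?) xs ∘ ys⊆)))  ⟩
    a + k * a                                    ∎
    where
    open ℕ.≤-Reasoning
    P? : ∀ x → Dec (c x ≡ k)
    P? x = c x ℕ.≟ k
    below′ : All (λ x → c x < k) (filter (∁? P?) xs)
    below′ = All.tabulate λ x∈ → let x∈xs , ck≢ = ∈-filter⁻ (∁? P?) {xs = xs} x∈ in
      ℕ.≤∧≢⇒< (ℕ.≤-pred (All.lookup below x∈xs)) ck≢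

  sublists : List A → List (List A)
  sublists [] = [] ∷ []
  sublists (x ∷ xs) = map (x ∷_) (sublists xs) ++ sublists xs

  sublists-⊆ : ∀ xs {ys} → ys ∈ sublists xs → ys ⊆ xs
  sublists-⊆ [] (here refl) ()
  sublists-⊆ (x ∷ xs) ys∈ with ∈-++⁻ (map (x ∷_) (sublists xs)) ys∈
  ... | inj₂ ys∈′ = there ∘ sublists-⊆ xs ys∈′
  ... | inj₁ ys∈′ with ∈-map⁻ (x ∷_) ys∈′
  ...   | zs , zs∈ , refl = λ { (here refl) → here refl ; (there z∈) → there (sublists-⊆ xs zs∈ z∈) }

  []∈sublists : ∀ xs → [] ∈ sublists xs
  []∈sublists [] = here refl
  []∈sublists (x ∷ xs) = ∈-++⁺ʳ (map (x ∷_) (sublists xs)) ([]∈sublists xs)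

  filter∈sublists : ∀ {P : A → Set} (P? : Decidable P) xs → filter P? xs ∈ sublists xs
  filter∈sublists P? [] = here refl
  filter∈sublists P? (x ∷ xs) with P? x
  ... | yes _ = ∈-++⁺ˡ (∈-map⁺ (x ∷_) (filter∈sublists P? xs))
  ... | no _  = ∈-++⁺ʳ (map (x ∷_) (sublists xs)) (filter∈sublists P? xs)

module _ {A I : Set} (B : I → List A) where

  tagged : List I → List (A × I)
  tagged [] = []
  tagged (i ∷ is) = map (_, i) (B i) ++ tagged is

  ∈-tagged⁻ : ∀ is {p} → p ∈ tagged is → proj₁ p ∈ B (proj₂ p) × proj₂ p ∈ is
  ∈-tagged⁻ (i ∷ is) p∈ with ∈-++⁻ (map (_, i) (B i)) p∈
  ... | inj₁ p∈′ with ∈-map⁻ (_, i) p∈′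
  ...   | x , x∈ , refl = x∈ , here refl
  ∈-tagged⁻ (i ∷ is) p∈ | inj₂ p∈′ = let x∈ , i∈ = ∈-tagged⁻ is p∈′ in x∈ , there i∈

  tagged-unique : ∀ {is} → Unique is → (∀ i → Unique (B i)) → Unique (tagged is)
  tagged-unique [] _ = []
  tagged-unique {i ∷ is} (i∉ ∷ uniq) uniqB =
    Unique.++⁺ (Unique.map⁺ (cong proj₁) (uniqB i)) (tagged-unique uniq uniqB) disjoint
    where
    disjoint : ∀ {p} → ¬ (p ∈ map (_, i) (B i) × p ∈ tagged is)
    disjoint (p∈ , p∈′) with ∈-map⁻ (_, i) p∈
    ... | x , _ , refl = All.lookup i∉ (proj₂ (∈-tagged⁻ is p∈′)) refl

  length-tagged : ∀ {a} is → All (λ i → length (B i) ≡ a) is → length (tagged is) ≡ length is * a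
  length-tagged [] [] = refl
  length-tagged {a} (i ∷ is) (len ∷ lens) = begin
    length (map (_, i) (B i) ++ tagged is)          ≡⟨ length-++ (map (_, i) (B i)) ⟩
    length (map (_, i) (B i)) + length (tagged is)  ≡⟨ cong₂ _+_ (≡.trans (length-map (_, i) (B i)) len)
                                                                 (length-tagged is lens) ⟩
    a + length is * a                               ∎
    where open ≡.≡-Reasoning

record DecGraph : Set₁ where
  field
    Vertex   : Set
    _≟_      : DecidableEquality Vertex
    _~_      : Vertex → Vertex → Set
    _~?_     : ∀ u v → Dec (u ~ v)
    ~-sym    : ∀ {u v} → u ~ v → v ~ u
    ~-irrefl : ∀ {u} → ¬ u ~ u

module _ (Γ : DecGraph) where
  open DecGraph Γ

  Clique : List Vertex → Set
  Clique = AllPairs _~_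

  record Colouring (S : List Vertex) (k : ℕ) : Set where
    constructor colouring
    field
      colour  : Vertex → ℕ
      bounded : ∀ {v} → v ∈ S → colour v < k
      proper  : ∀ {u v} → u ∈ S → v ∈ S → u ~ v → colour u ≢ colour v

  record LargeClique (S : List Vertex) (k : ℕ) : Set where
    constructor largeClique
    field
      members  : List Vertex
      members⊆ : members ⊆ S
      isClique : Clique members
      large    : k ≤ length members

  -- A k-colouring together with a clique of size at least k certifies χ = ω = k.
  χ=ω : List Vertex → Set
  χ=ω S = ∃[ k ] (Colouring S k × LargeClique S k)

  PerfectOn : List Vertex → Set
  PerfectOn S = ∀ T → Unique T → T ⊆ S → χ=ω T

complement : DecGraph → DecGraph
complement Γ = record
  { Vertex   = Vertex
  ; _≟_      = _≟_
  ; _~_      = λ u v → u ≢ v × ¬ u ~ v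
  ; _~?_     = λ u v → ¬? (u ≟ v) ×-dec ¬? (u ~? v)
  ; ~-sym    = λ (u≢v , u≁v) → u≢v ∘ ≡.sym , u≁v ∘ ~-sym
  ; ~-irrefl = λ (u≢u , _) → u≢u refl
  }
  where open DecGraph Γ

blowUp : DecGraph → (I : Set) → DecidableEquality I → DecGraph
blowUp Γ I _≟ᴵ_ = record
  { Vertex   = Vertex × I
  ; _≟_      = Product.≡-dec _≟_ _≟ᴵ_
  ; _~_      = _≈_
  ; _~?_     = λ (x , i) (y , j) → ((x ≟ y) ×-dec ¬? (i ≟ᴵ j)) ⊎-dec (x ~? y)
  ; ~-sym    = λ { (inj₁ (x≡y , i≢j)) → inj₁ (≡.sym x≡y , i≢j ∘ ≡.sym) ; (inj₂ x~y) → inj₂ (~-sym x~y) }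
  ; ~-irrefl = λ { (inj₁ (_ , i≢i)) → i≢i refl ; (inj₂ x~x) → ~-irrefl x~x }
  }
  where
  open DecGraph Γ
  _≈_ : Vertex × I → Vertex × I → Set
  (x , i) ≈ (y , j) = (x ≡ y × i ≢ j) ⊎ x ~ y

module _ {Γ : DecGraph} where
  open DecGraph Γ

  Clique⇒Unique : ∀ {Q} → Clique Γ Q → Unique Q
  Clique⇒Unique = AllPairs.map λ { u~v refl → ~-irrefl u~v }

  clique-adjacent : ∀ {Q} → Clique Γ Q → ∀ {u v} → u ∈ Q → v ∈ Q → u ≢ v → u ~ v
  clique-adjacent = AllPairs-∈ ~-sym

  largeClique-⊆ : ∀ {S T k} → S ⊆ T → LargeClique Γ S k → LargeClique Γ T k
  largeClique-⊆ S⊆T (largeClique Q Q⊆ isClique large) = largeClique Q (S⊆T ∘ Q⊆) isClique large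

  colouring-≤ : ∀ {S k k′} → k ≤ k′ → Colouring Γ S k → Colouring Γ S k′
  colouring-≤ k≤k′ (colouring c bounded proper) = colouring c (λ v∈ → ℕ.<-≤-trans (bounded v∈) k≤k′) proper

  perfectOn-⊆ : ∀ {S T} → T ⊆ S → PerfectOn Γ S → PerfectOn Γ T
  perfectOn-⊆ T⊆S perfect U uniq U⊆T = perfect U uniq (T⊆S ∘ U⊆T)

  clique-colours-unique : ∀ {S k Q} (c : Colouring Γ S k) → Q ⊆ S → Clique Γ Q →
                          Unique (map (Colouring.colour c) Q)
  clique-colours-unique c Q⊆ isClique = AllPairs.map⁺ (AllPairs-from-∈ (Clique⇒Unique isClique)
    λ u∈ v∈ u≢v → Colouring.proper c (Q⊆ u∈) (Q⊆ v∈) (clique-adjacent isClique u∈ v∈ u≢v))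

  recolour : ∀ {S k} {X : Vertex → Set} (X? : Decidable X) →
             (∀ {u v} → u ∈ S → v ∈ S → X u → X v → ¬ u ~ v) →
             Colouring Γ (filter (∁? X?) S) k → Colouring Γ S (suc k)
  recolour {S} {k} {X} X? stable (colouring c bounded proper) = colouring c′ bounded′ proper′
    where
    c′ : Vertex → ℕ
    c′ v with X? v
    ... | yes _ = k
    ... | no _  = c v

    bounded′ : ∀ {v} → v ∈ S → c′ v < suc k
    bounded′ {v} v∈ with X? v
    ... | yes _ = ℕ.≤-refl
    ... | no ¬x = ℕ.m≤n⇒m≤1+n (bounded (∈-filter⁺ (∁? X?) v∈ ¬x))

    proper′ : ∀ {u v} → u ∈ S → v ∈ S → u ~ v → c′ u ≢ c′ v
    proper′ {u} {v} u∈ v∈ u~v with X? u | X? v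
    ... | yes xu | yes xv = λ _ → stable u∈ v∈ xu xv u~v
    ... | yes _  | no ¬xv = λ k≡ → ℕ.<-irrefl (≡.sym k≡) (bounded (∈-filter⁺ (∁? X?) v∈ ¬xv))
    ... | no ¬xu | yes _  = λ ≡k → ℕ.<-irrefl ≡k (bounded (∈-filter⁺ (∁? X?) u∈ ¬xu))
    ... | no ¬xu | no ¬xv = proper (∈-filter⁺ (∁? X?) u∈ ¬xu) (∈-filter⁺ (∁? X?) v∈ ¬xv) u~v

-- Lovász's replication lemma

module Replication (Γ : DecGraph) {I : Set} (_≟ᴵ_ : DecidableEquality I) where
  open DecGraph Γ
  Γ′ : DecGraph
  Γ′ = blowUp Γ I _≟ᴵ_
  open DecGraph Γ′ using () renaming (_≟_ to _≟′_; _~_ to _~′_; ~-sym to ~′-sym; ~-irrefl to ~′-irrefl)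

  Base : Vertex × I → Vertex
  Base = proj₁

  copies-adjacent : ∀ {p q} → Base p ≡ Base q → p ≢ q → p ~′ q
  copies-adjacent {x , i} refl p≢q = inj₁ (refl , p≢q ∘ cong (x ,_))

  twin : ∀ {p q r} → Base p ≡ Base q → r ~′ p → r ≢ q → r ~′ q
  twin {_ , i} {_ , j} {y , l} refl (inj₁ (y≡x , _)) r≢q = inj₁ (y≡x , λ l≡j → r≢q (≡.cong₂ _,_ y≡x l≡j))
  twin refl (inj₂ y~x) _ = inj₂ y~x

  Copyless : List (Vertex × I) → Set
  Copyless T = ∀ {p q} → p ∈ T → q ∈ T → Base p ≡ Base q → p ≡ q

  copies? : ∀ T → (∃[ p ] ∃[ q ] (p ∈ T × q ∈ T × p ≢ q × Base p ≡ Base q)) ⊎ Copyless T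
  copies? T with Any.any? (λ q → Any.any? (λ p → ¬? (p ≟′ q) ×-dec (Base p ≟ Base q)) T) T
  ... | yes copy = let q , q∈ , p-copy = find copy ; p , p∈ , p≢q , p≈q = find p-copy in
                   inj₁ (p , q , p∈ , q∈ , p≢q , p≈q)
  ... | no ¬copy = inj₂ copyless
    where
    copyless : Copyless T
    copyless {p} {q} p∈ q∈ p≈q with p ≟′ q
    ... | yes p≡q = p≡q
    ... | no p≢q = ⊥-elim (¬copy (lose q∈ (lose p∈ (p≢q , p≈q))))

  module _ {S} (perfect : PerfectOn Γ S) where

    copyless-χ=ω : ∀ {T} → Unique T → map Base T ⊆ S → Copyless T → χ=ω Γ′ T
    copyless-χ=ω {T} uniq bases copyless with perfect (map Base T) uniqueBases bases
      where
      uniqueBases : Unique (map Base T)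
      uniqueBases = AllPairs.map⁺ (AllPairs-from-∈ uniq λ p∈ q∈ p≢q → p≢q ∘ copyless p∈ q∈)
    ... | k , colouring c bounded proper , largeClique Q Q⊆ isClique large =
      k , colouring (c ∘ Base) (bounded ∘ ∈-map⁺ Base) proper′ ,
          largeClique Q′ (Subset.filter-⊆ inQ? T) isClique′ large′
      where
      proper′ : ∀ {p q} → p ∈ T → q ∈ T → p ~′ q → c (Base p) ≢ c (Base q)
      proper′ p∈ q∈ (inj₁ (p≈q , tags≢)) = ⊥-elim (tags≢ (cong proj₂ (copyless p∈ q∈ p≈q)))
      proper′ p∈ q∈ (inj₂ x~y) = proper (∈-map⁺ Base p∈) (∈-map⁺ Base q∈) x~y

      inQ? : ∀ p → Dec (Base p ∈ Q)
      inQ? p = Any.any? (Base p ≟_) Q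

      Q′ : List (Vertex × I)
      Q′ = filter inQ? T

      isClique′ : Clique Γ′ Q′
      isClique′ = AllPairs-from-∈ (Unique.filter⁺ inQ? uniq) λ p∈ q∈ p≢q →
        let p∈T , p∈Q = ∈-filter⁻ inQ? {xs = T} p∈ ; q∈T , q∈Q = ∈-filter⁻ inQ? {xs = T} q∈ in
        inj₂ (clique-adjacent {Γ} isClique p∈Q q∈Q (p≢q ∘ copyless p∈T q∈T))

      Q⊆bases : Q ⊆ map Base Q′
      Q⊆bases x∈ with ∈-map⁻ Base (Q⊆ x∈)
      ... | p , p∈ , refl = ∈-map⁺ Base (∈-filter⁺ inQ? p∈ x∈)

      large′ : k ≤ length Q′
      large′ = ℕ.≤-trans large (ℕ.≤-trans (⊆-length (Clique⇒Unique {Γ} isClique) Q⊆bases)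
                                          (ℕ.≤-reflexive (length-map Base Q′)))

    -- Lovász's step for a copy q of p: colour T₀ = T − q with k colours, with a clique Q of size
    -- k, and colour T₁ = T − (q and the rest of p's colour class) with k₁ colours.  If k₁ < k, the
    -- removed vertices form one stable set and take one new colour; otherwise a largest clique of
    -- T₁ needs all k colours of T₀, so it contains p, and q extends it.
    module WithCopy {T} (uniq : Unique T) (bases : map Base T ⊆ S)
                    (IH : ∀ T′ → length T′ < length T → Unique T′ → map Base T′ ⊆ S → χ=ω Γ′ T′)
                    {p q} (p∈ : p ∈ T) (q∈ : q ∈ T) (p≢q : p ≢ q) (p≈q : Base p ≡ Base q) where

      χ=ω-without : ∀ {X : Vertex × I → Set} (X? : Decidable X) → X q → χ=ω Γ′ (filter (∁? X?) T)
      χ=ω-without X? xq =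
        IH _ (filter-notAll (∁? X?) T (lose q∈ (λ ¬xq → ¬xq xq))) (Unique.filter⁺ (∁? X?) uniq) bases′
        where
        bases′ : map Base (filter (∁? X?) T) ⊆ S
        bases′ x∈ with ∈-map⁻ Base x∈
        ... | r , r∈ , refl = bases (∈-map⁺ Base (Subset.filter-⊆ (∁? X?) T r∈))

      T₀ : List (Vertex × I)
      T₀ = filter (∁? (_≟′ q)) T

      T₀⊆T : T₀ ⊆ T
      T₀⊆T = Subset.filter-⊆ (∁? (_≟′ q)) T

      ∈T₀ : ∀ {r} → r ∈ T → r ≢ q → r ∈ T₀
      ∈T₀ = ∈-filter⁺ (∁? (_≟′ q))

      ∉q : ∀ {r} → r ∈ T₀ → r ≢ q
      ∉q = proj₂ ∘ ∈-filter⁻ (∁? (_≟′ q)) {xs = T}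

      module _ {k} (c : Colouring Γ′ T₀ k) (Q : LargeClique Γ′ T₀ k) where
        open Colouring c

        Mate : Vertex × I → Set
        Mate r = r ≡ q ⊎ (r ≢ q × r ≢ p × colour r ≡ colour p)

        Mate? : Decidable Mate
        Mate? r = (r ≟′ q) ⊎-dec (¬? (r ≟′ q) ×-dec ¬? (r ≟′ p) ×-dec (colour r ℕ.≟ colour p))

        T₁ : List (Vertex × I)
        T₁ = filter (∁? Mate?) T

        T₁⊆T₀ : T₁ ⊆ T₀
        T₁⊆T₀ r∈ = let r∈T , ¬mate = ∈-filter⁻ (∁? Mate?) {xs = T} r∈ in ∈T₀ r∈T (¬mate ∘ inj₁)

        mates-stable : ∀ {u v} → u ∈ T → v ∈ T → Mate u → Mate v → ¬ u ~′ v
        mates-stable _ _ (inj₁ refl) (inj₁ refl) = ~′-irrefl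
        mates-stable _ v∈ (inj₁ refl) (inj₂ (v≢q , v≢p , cv≡cp)) q~v =
          proper (∈T₀ v∈ v≢q) (∈T₀ p∈ p≢q) (twin (≡.sym p≈q) (~′-sym q~v) v≢p) cv≡cp
        mates-stable u∈ _ (inj₂ (u≢q , u≢p , cu≡cp)) (inj₁ refl) u~q =
          proper (∈T₀ u∈ u≢q) (∈T₀ p∈ p≢q) (twin (≡.sym p≈q) u~q u≢p) cu≡cp
        mates-stable u∈ v∈ (inj₂ (u≢q , _ , cu≡cp)) (inj₂ (v≢q , _ , cv≡cp)) u~v =
          proper (∈T₀ u∈ u≢q) (∈T₀ v∈ v≢q) u~v (≡.trans cu≡cp (≡.sym cv≡cp))

        fewer-colours : ∀ {k₁} → k₁ < k → Colouring Γ′ T₁ k₁ → χ=ω Γ′ T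
        fewer-colours k₁<k c₁ = k , colouring-≤ k₁<k (recolour Mate? mates-stable c₁) , largeClique-⊆ T₀⊆T Q

        module _ {k₁} (k≤k₁ : k ≤ k₁) (Q₁ : LargeClique Γ′ T₁ k₁) where
          open LargeClique Q₁

          colour-p∈ : colour p ∈ map colour members
          colour-p∈ = unique-below-surjective k (clique-colours-unique c (T₁⊆T₀ ∘ members⊆) isClique)
            (All.map⁺ (All.tabulate (bounded ∘ T₁⊆T₀ ∘ members⊆)))
            (ℕ.≤-trans k≤k₁ (ℕ.≤-trans large (ℕ.≤-reflexive (≡.sym (length-map colour members)))))
            (bounded (∈T₀ p∈ p≢q))

          p∈Q₁ : p ∈ members
          p∈Q₁ with ∈-map⁻ colour colour-p∈
          ... | r , r∈ , cp≡cr with r ≟′ p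
          ...   | yes refl = r∈
          ...   | no r≢p = ⊥-elim (proj₂ (∈-filter⁻ (∁? Mate?) {xs = T} (members⊆ r∈))
                                     (inj₂ (∉q (T₁⊆T₀ (members⊆ r∈)) , r≢p , ≡.sym cp≡cr)))

          q-adjacent : All (q ~′_) members
          q-adjacent = All.tabulate λ {r} r∈ → ~′-sym (q-twin r∈)
            where
            q-twin : ∀ {r} → r ∈ members → r ~′ q
            q-twin {r} r∈ with r ≟′ p
            ... | yes refl = copies-adjacent p≈q p≢q
            ... | no r≢p = twin p≈q (clique-adjacent {Γ′} isClique r∈ p∈Q₁ r≢p)
                                    (∉q (T₁⊆T₀ (members⊆ r∈)))

          more-colours : χ=ω Γ′ T
          more-colours = suc k , recolour (_≟′ q) (λ { _ _ refl refl → ~′-irrefl }) c ,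
            largeClique (q ∷ members) (λ { (here refl) → q∈ ; (there r∈) → T₀⊆T (T₁⊆T₀ (members⊆ r∈)) })
                        (q-adjacent ∷ isClique) (s≤s (ℕ.≤-trans k≤k₁ large))

      χ=ω-T : χ=ω Γ′ T
      χ=ω-T with χ=ω-without (_≟′ q) refl
      ... | k , c , Q with χ=ω-without (Mate? c Q) (inj₁ refl)
      ...   | k₁ , c₁ , Q₁ with k₁ ℕ.<? k
      ...     | yes k₁<k = fewer-colours c Q k₁<k c₁
      ...     | no k₁≮k = more-colours c Q (ℕ.≮⇒≥ k₁≮k) Q₁

    replication-≤ : ∀ n T → length T ≤ n → Unique T → map Base T ⊆ S → χ=ω Γ′ T
    replication-≤ n T len uniq bases with copies? T
    ... | inj₂ copyless = copyless-χ=ω uniq bases copyless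
    replication-≤ (suc n) T len uniq bases | inj₁ (p , q , p∈ , q∈ , p≢q , p≈q) =
      WithCopy.χ=ω-T uniq bases (λ T′ T′<T → replication-≤ n T′ (ℕ.≤-pred (ℕ.≤-trans T′<T len)))
                     p∈ q∈ p≢q p≈q
    replication-≤ zero [] _ _ _ | inj₁ (_ , _ , () , _)

    replication : ∀ T → Unique T → map Base T ⊆ S → χ=ω Γ′ T
    replication T = replication-≤ (length T) T ℕ.≤-refl

-- The weak perfect graph theorem

module Lovász (Γ : DecGraph) where
  open DecGraph Γ
  open import Data.List.Membership.DecPropositional _≟_ using (_∈?_)

  Γᶜ : DecGraph
  Γᶜ = complement Γ

  Stable : List Vertex → Set
  Stable = Clique Γᶜ

  Meets : List Vertex → List Vertex → Set
  Meets K A = Any (_∈ K) A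

  module _ {S : List Vertex} (uniqS : Unique S) where

    stableSets : List (List Vertex)
    stableSets = filter (AllPairs.allPairs? (DecGraph._~?_ Γᶜ)) (sublists S)

    ∈stableSets : ∀ {A} → Stable A → A ⊆ S → filter (_∈? A) S ∈ stableSets × A ⊆ filter (_∈? A) S
    ∈stableSets {A} stable A⊆S =
      ∈-filter⁺ (AllPairs.allPairs? (DecGraph._~?_ Γᶜ)) (filter∈sublists (_∈? A) S)
        (AllPairs-from-∈ (Unique.filter⁺ (_∈? A) uniqS) λ x∈ y∈ →
           AllPairs-∈ (DecGraph.~-sym Γᶜ) stable (proj₂ (∈-filter⁻ (_∈? A) {xs = S} x∈))
                                                 (proj₂ (∈-filter⁻ (_∈? A) {xs = S} y∈))) ,
      λ x∈ → ∈-filter⁺ (_∈? A) (A⊆S x∈) x∈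

    stableSets-stable : ∀ {A} → A ∈ stableSets → A ⊆ S × Stable A
    stableSets-stable A∈ =
      let A∈sub , stable = ∈-filter⁻ (AllPairs.allPairs? (DecGraph._~?_ Γᶜ)) {xs = sublists S} A∈ in
      sublists-⊆ S A∈sub , stable

    A₀ : List Vertex
    A₀ = argmax length [] stableSets

    α : ℕ
    α = length A₀

    A₀∈stableSets : A₀ ∈ stableSets
    A₀∈stableSets = argmax-all length (∈-filter⁺ (AllPairs.allPairs? (DecGraph._~?_ Γᶜ)) ([]∈sublists S) [])
                                      (All.tabulate (λ A∈ → A∈))

    ≤α : ∀ {A} → A ∈ stableSets → length A ≤ α
    ≤α = All.lookup (f[xs]≤f[argmax] {f = length} [] stableSets)

    A₀⊆S : A₀ ⊆ S
    A₀⊆S = proj₁ (stableSets-stable A₀∈stableSets)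

    A₀-stable : Stable A₀
    A₀-stable = proj₂ (stableSets-stable A₀∈stableSets)

    stable-≤α : ∀ {A} → Stable A → A ⊆ S → length A ≤ α
    stable-≤α {A} stable A⊆S = let A′∈ , A⊆A′ = ∈stableSets stable A⊆S in
      ℕ.≤-trans (⊆-length (Clique⇒Unique {Γᶜ} stable) A⊆A′) (≤α A′∈)

    maximumStableSets : List (List Vertex)
    maximumStableSets = filter (λ A → length A ℕ.≟ α) stableSets

    meets-maximum : ∀ {K A} → All (Meets K) maximumStableSets → Stable A → A ⊆ S → α ≤ length A → Meets K A
    meets-maximum {K} {A} meetsAll stable A⊆S α≤ =
      let A′∈ , A⊆A′ = ∈stableSets stable A⊆S
          A′-size = ℕ.≤-antisym (≤α A′∈) (ℕ.≤-trans α≤ (⊆-length (Clique⇒Unique {Γᶜ} stable) A⊆A′))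
          y , y∈A′ , y∈K = find (All.lookup meetsAll (∈-filter⁺ (λ A → length A ℕ.≟ α) A′∈ A′-size))
      in lose (proj₂ (∈-filter⁻ (_∈? A) {xs = S} y∈A′)) y∈K

    maximum-stable : ∀ {A} → A ∈ maximumStableSets → A ⊆ S × Stable A × length A ≡ α
    maximum-stable A∈ = let A∈stable , size = ∈-filter⁻ (λ A → length A ℕ.≟ α) {xs = stableSets} A∈ in
      proj₁ (stableSets-stable A∈stable) , proj₂ (stableSets-stable A∈stable) , size

    cliques : List (List Vertex)
    cliques = filter (AllPairs.allPairs? _~?_) (sublists S)

    -- If every clique K misses a maximum stable set A_K, give every x one copy for each K with
    -- x ∈ A_K.  The replicated graph S′ has |cliques| · α vertices and its colour classes have at
    -- most α vertices, but a clique of S′ uses each A_K at most once and never the A_K of its own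
    -- projection, so it has fewer than |cliques| vertices, contradicting χ = ω on S′.
    module CliqueAvoidingEveryMaximumStableSet
             (perfect : PerfectOn Γ S) {s} (s∈ : s ∈ S)
             (avoids : ∀ {K} → K ∈ cliques → Any (λ A → ¬ Meets K A) maximumStableSets) where

      L : ℕ
      L = length cliques

      -- The [] branch is unreachable: every clique misses some maximum stable set.
      avoider : Fin L → List Vertex
      avoider i with Any.any? (λ A → ¬? (Any.any? (_∈? lookup cliques i) A)) maximumStableSets
      ... | yes avoiding = proj₁ (find avoiding)
      ... | no _ = []

      avoider-spec : ∀ i → avoider i ∈ maximumStableSets × ¬ Meets (lookup cliques i) (avoider i)
      avoider-spec i with Any.any? (λ A → ¬? (Any.any? (_∈? lookup cliques i) A)) maximumStableSets
      ... | yes avoiding = proj₂ (find avoiding)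
      ... | no ¬avoiding = ⊥-elim (¬avoiding (avoids (∈-lookup i)))

      open Replication Γ {Fin L} Fin._≟_

      S′ : List (Vertex × Fin L)
      S′ = tagged avoider (allFin L)

      S′-unique : Unique S′
      S′-unique = tagged-unique avoider (Unique.allFin⁺ L)
                    (λ i → Clique⇒Unique {Γᶜ} (proj₁ (proj₂ (maximum-stable (proj₁ (avoider-spec i))))))

      S′-length : length S′ ≡ L * α
      S′-length = ≡.trans (length-tagged avoider (allFin L) (All.tabulate λ {i} _ → avoider-size i))
                          (cong (_* α) (length-tabulate {n = L} (λ i → i)))
        where
        avoider-size : ∀ i → length (avoider i) ≡ α
        avoider-size i = proj₂ (proj₂ (maximum-stable (proj₁ (avoider-spec i))))

      ∈avoider : ∀ {p} → p ∈ S′ → Base p ∈ avoider (proj₂ p)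
      ∈avoider = proj₁ ∘ ∈-tagged⁻ avoider (allFin L)

      S′-bases : map Base S′ ⊆ S
      S′-bases x∈ with ∈-map⁻ Base x∈
      ... | p , p∈ , refl = proj₁ (maximum-stable (proj₁ (avoider-spec (proj₂ p)))) (∈avoider p∈)

      module _ {k} (c : Colouring Γ′ S′ k) (Q : LargeClique Γ′ S′ k) where
        open Colouring c
        open LargeClique Q

        colour-class-≤α : ∀ i ys → Unique ys → ys ⊆ S′ → All (λ y → colour y ≡ i) ys → length ys ≤ α
        colour-class-≤α i ys uniq ys⊆ same = begin
          length ys             ≡⟨ length-map Base ys ⟨
          length (map Base ys)  ≤⟨ stable-≤α bases-stable (S′-bases ∘ Subset.map⁺ Base ys⊆) ⟩
          α                     ∎
          where
          open ℕ.≤-Reasoning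
          bases-stable : Stable (map Base ys)
          bases-stable = AllPairs.map⁺ (AllPairs-from-∈ uniq λ p∈ q∈ p≢q →
            let same-colour = ≡.trans (All.lookup same p∈) (≡.sym (All.lookup same q∈)) in
            (λ p≈q → proper (ys⊆ p∈) (ys⊆ q∈) (copies-adjacent p≈q p≢q) same-colour) ,
            (λ x~y → proper (ys⊆ p∈) (ys⊆ q∈) (inj₂ x~y) same-colour))

        avoider-stable : ∀ i → Stable (avoider i)
        avoider-stable i = proj₁ (proj₂ (maximum-stable (proj₁ (avoider-spec i))))

        tags-distinct : ∀ {p q} → p ∈ members → q ∈ members → p ≢ q → proj₂ p ≢ proj₂ q
        tags-distinct {x , i} {y , .i} p∈ q∈ p≢q refl with clique-adjacent {Γ′} isClique p∈ q∈ p≢q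
        ... | inj₁ (_ , i≢i) = i≢i refl
        ... | inj₂ x~y = proj₂ (AllPairs-∈ (DecGraph.~-sym Γᶜ) (avoider-stable i)
                                 (∈avoider (members⊆ p∈)) (∈avoider (members⊆ q∈)) (λ { refl → p≢q refl })) x~y

        bases-adjacent : ∀ {x y} → x ∈ map Base members → y ∈ map Base members → x ≢ y → x ~ y
        bases-adjacent x∈ y∈ x≢y with ∈-map⁻ Base x∈ | ∈-map⁻ Base y∈
        ... | p , p∈ , refl | q , q∈ , refl with clique-adjacent {Γ′} isClique p∈ q∈ (x≢y ∘ cong Base)
        ...   | inj₁ (x≡y , _) = ⊥-elim (x≢y x≡y)
        ...   | inj₂ x~y = x~y

        K : List Vertex
        K = filter (_∈? map Base members) S

        K∈cliques : K ∈ cliques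
        K∈cliques = ∈-filter⁺ (AllPairs.allPairs? _~?_) (filter∈sublists (_∈? map Base members) S)
          (AllPairs-from-∈ (Unique.filter⁺ (_∈? map Base members) uniqS) λ x∈ y∈ →
            bases-adjacent (proj₂ (∈-filter⁻ (_∈? map Base members) {xs = S} x∈))
                           (proj₂ (∈-filter⁻ (_∈? map Base members) {xs = S} y∈)))

        tag≢K : ∀ {p} → p ∈ members → proj₂ p ≢ Any.index K∈cliques
        tag≢K {x , i} p∈ refl = proj₂ (avoider-spec i)
          (≡.subst (λ K′ → Meets K′ (avoider i)) (lookup-index K∈cliques) (lose (∈avoider (members⊆ p∈)) x∈K))
          where
          x∈K : x ∈ K
          x∈K = ∈-filter⁺ (_∈? map Base members) (S′-bases (∈-map⁺ Base (members⊆ p∈))) (∈-map⁺ Base p∈)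

        clique-<L : length members < L
        clique-<L = begin-strict
          length members                                       ≡⟨ length-map proj₂ members ⟨
          length (map proj₂ members)                           ≤⟨ ⊆-length tags-unique tags⊆ ⟩
          length (filter (∁? (Fin._≟ Any.index K∈cliques)) (allFin L))
            <⟨ filter-notAll (∁? (Fin._≟ Any.index K∈cliques)) (allFin L) (lose (∈-allFin _) (λ ¬≡ → ¬≡ refl)) ⟩
          length (allFin L)                                    ≡⟨ length-tabulate {n = L} (λ i → i) ⟩
          L                                                    ∎
          where
          open ℕ.≤-Reasoning
          tags-unique : Unique (map proj₂ members)
          tags-unique = AllPairs.map⁺ (AllPairs-from-∈ (Clique⇒Unique {Γ′} isClique) tags-distinct)
          tags⊆ : map proj₂ members ⊆ filter (∁? (Fin._≟ Any.index K∈cliques)) (allFin L)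
          tags⊆ i∈ with ∈-map⁻ proj₂ i∈
          ... | p , p∈ , refl = ∈-filter⁺ (∁? (Fin._≟ Any.index K∈cliques)) (∈-allFin _) (tag≢K p∈)

        impossible : ⊥
        impossible = ℕ.<-irrefl refl L*α<L*α
          where
          open ℕ.≤-Reasoning
          L*α<L*α : L * α < L * α
          L*α<L*α = begin-strict
            L * α       ≡⟨ S′-length ⟨
            length S′   ≤⟨ length-≤-classes colour α k S′ S′-unique (All.tabulate bounded) colour-class-≤α ⟩
            k * α       <⟨ ℕ.m<n+m (k * α) (stable-≤α ([] ∷ []) (λ { (here refl) → s∈ })) ⟩
            suc k * α   ≤⟨ ℕ.*-monoˡ-≤ α (ℕ.≤-<-trans large clique-<L) ⟩
            L * α       ∎

    clique-meeting-maximum-stable-sets : PerfectOn Γ S → ∀ {s} → s ∈ S →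
      ∃[ K ] (Clique Γ K × All (Meets K) maximumStableSets)
    clique-meeting-maximum-stable-sets perfect s∈
      with Any.any? (λ K → All.all? (Any.any? (_∈? K)) maximumStableSets) cliques
    ... | yes meeting = let K , K∈ , meetsAll = find meeting in
                        K , proj₂ (∈-filter⁻ (AllPairs.allPairs? _~?_) {xs = sublists S} K∈) , meetsAll
    ... | no ¬meeting =
      let _ , c , Q = Replication.replication Γ Fin._≟_ perfect S′ S′-unique S′-bases in ⊥-elim (impossible c Q)
      where
      avoids : ∀ {K} → K ∈ cliques → Any (λ A → ¬ Meets K A) maximumStableSets
      avoids K∈ = All.¬All⇒Any¬ (Any.any? (_∈? _)) maximumStableSets (¬meeting ∘ lose K∈)
      open CliqueAvoidingEveryMaximumStableSet perfect s∈ avoids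

    removing-meeting-clique-shortens : ∀ {K} → All (Meets K) maximumStableSets →
                                       length (filter (∁? (_∈? K)) S) < length S
    removing-meeting-clique-shortens {K} meetsAll =
      let x , x∈A₀ , x∈K = find (meets-maximum meetsAll A₀-stable A₀⊆S ℕ.≤-refl) in
      filter-notAll (∁? (_∈? K)) S (lose (A₀⊆S x∈A₀) (λ x∉K → x∉K x∈K))

    remove-clique : ∀ {K} → Clique Γ K → All (Meets K) maximumStableSets →
                    χ=ω Γᶜ (filter (∁? (_∈? K)) S) → χ=ω Γᶜ S
    remove-clique {K} isClique meetsAll (k , c , largeClique I I⊆ stableI large) =
      suc k , recolour {Γᶜ} (_∈? K) K-costable c , largeClique A₀ A₀⊆S A₀-stable (ℕ.≤-<-trans large I<α)
      where
      K-costable : ∀ {u v} → u ∈ S → v ∈ S → u ∈ K → v ∈ K → ¬ (u ≢ v × ¬ u ~ v)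
      K-costable _ _ u∈ v∈ (u≢v , u≁v) = u≁v (clique-adjacent {Γ} isClique u∈ v∈ u≢v)

      I⊆S : I ⊆ S
      I⊆S = Subset.filter-⊆ (∁? (_∈? K)) S ∘ I⊆

      I<α : length I < α
      I<α = ℕ.≤∧≢⇒< (stable-≤α stableI I⊆S) λ I≡α →
        let y , y∈I , y∈K = find (meets-maximum meetsAll stableI I⊆S (ℕ.≤-reflexive (≡.sym I≡α))) in
        proj₂ (∈-filter⁻ (∁? (_∈? K)) {xs = S} (I⊆ y∈I)) y∈K

  complement-χ=ω-≤ : ∀ n S → length S ≤ n → Unique S → PerfectOn Γ S → χ=ω Γᶜ S
  complement-χ=ω-≤ _ [] _ _ _ = 0 , colouring (λ _ → 0) (λ ()) (λ ()) , largeClique [] (λ ()) [] z≤n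
  complement-χ=ω-≤ (suc n) (s ∷ S) len uniq perfect =
    let K , isClique , meetsAll = clique-meeting-maximum-stable-sets uniq perfect (here refl) in
    remove-clique uniq isClique meetsAll
      (complement-χ=ω-≤ n (filter (∁? (_∈? K)) (s ∷ S))
        (ℕ.≤-pred (ℕ.<-≤-trans (removing-meeting-clique-shortens uniq meetsAll) len))
        (Unique.filter⁺ (∁? (_∈? K)) uniq)
        (perfectOn-⊆ (Subset.filter-⊆ (∁? (_∈? K)) (s ∷ S)) perfect))

  -- Colourings of the complement are clique covers and its cliques are stable sets: this is k = α.
  perfect⇒complement-χ=ω : ∀ {S} → Unique S → PerfectOn Γ S → χ=ω Γᶜ S
  perfect⇒complement-χ=ω {S} = complement-χ=ω-≤ (length S) S ℕ.≤-refl

pair : ∀ {m} → Fin m → Fin m → Fin 2 → Fin m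
pair u v 0F = u
pair u v 1F = v

pair-injective : ∀ {m} {u v : Fin m} → u ≢ v → Injective _≡_ _≡_ (pair u v)
pair-injective u≢v {0F} {0F} _ = refl
pair-injective u≢v {0F} {1F} u≡v = ⊥-elim (u≢v u≡v)
pair-injective u≢v {1F} {0F} v≡u = ⊥-elim (u≢v (≡.sym v≡u))
pair-injective u≢v {1F} {1F} _ = refl

module _ {m} (F : Graph m) where

  pair-adjacent : ∀ {u v} i j → i ≢ j → Adj F (pair u v i) (pair u v j) → Adj F u v
  pair-adjacent 0F 1F _ a = a
  pair-adjacent 1F 0F _ a = sym F a
  pair-adjacent 0F 0F i≢i _ = ⊥-elim (i≢i refl)
  pair-adjacent 1F 1F i≢i _ = ⊥-elim (i≢i refl)

  adjacent-pair : ∀ {u v} → Adj F u v → IsClique (induce F (pair u v)) 2 (λ i → i)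
  adjacent-pair u~v = (λ e → e) , λ where
    0F 1F _ → u~v
    1F 0F _ → sym F u~v
    0F 0F i≢i → ⊥-elim (i≢i refl)
    1F 1F i≢i → ⊥-elim (i≢i refl)

  -- Adjacency of u ≢ v is read off the clique number of the subgraph induced on {u, v}.
  perfect⇒adjacent? : Perfect F → ∀ u v → Dec (Adj F u v)
  perfect⇒adjacent? perfect u v with u Fin.≟ v
  ... | yes refl = no (irrefl F)
  ... | no u≢v with perfect 2 (pair u v) (pair-injective u≢v)
  ...   | k , _ , ((g , g-injective , g-adjacent) , largest) with 2 ℕ.≤? k
  ...     | yes (s≤s (s≤s _)) = yes (pair-adjacent (g 0F) (g 1F) ((λ ()) ∘ g-injective) (g-adjacent 0F 1F λ ()))
  ...     | no 2≰k = no λ u~v → 2≰k (largest 2 (λ i → i) (adjacent-pair u~v))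

  module _ (adj? : ∀ u v → Dec (Adj F u v)) where

    asDecGraph : DecGraph
    asDecGraph = record
      { Vertex = Fin m ; _≟_ = Fin._≟_ ; _~_ = Adj F ; _~?_ = adj? ; ~-sym = sym F ; ~-irrefl = irrefl F }

    open import Data.List.Membership.DecPropositional (Fin._≟_ {m}) using (_∈?_)

    module _ {T : List (Fin m)} {k} (col : Fin (length T) → Fin k) (proper : IsProper (induce F (lookup T)) k col) where

      colourAt : Fin m → ℕ
      colourAt v with v ∈? T
      ... | yes v∈ = toℕ (col (Any.index v∈))
      ... | no _ = 0

      colourAt-spec : ∀ {v} → v ∈ T → ∃[ i ] (lookup T i ≡ v × colourAt v ≡ toℕ (col i))
      colourAt-spec {v} v∈ with v ∈? T
      ... | yes v∈′ = Any.index v∈′ , ≡.sym (lookup-index v∈′) , refl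
      ... | no v∉ = ⊥-elim (v∉ v∈)

      asColouring : Colouring asDecGraph T k
      asColouring = colouring colourAt bounded proper′
        where
        bounded : ∀ {v} → v ∈ T → colourAt v < k
        bounded v∈ with colourAt-spec v∈
        ... | i , _ , e = ≡.subst (_< k) (≡.sym e) (toℕ<n (col i))
        proper′ : ∀ {u v} → u ∈ T → v ∈ T → Adj F u v → colourAt u ≢ colourAt v
        proper′ u∈ v∈ u~v e with colourAt-spec u∈ | colourAt-spec v∈
        ... | i , refl , e₁ | j , refl , e₂ = proper i j u~v (toℕ-injective (≡.trans (≡.sym e₁) (≡.trans e (e₂))))

    perfect⇒perfectOn : Perfect F → PerfectOn asDecGraph (allFin m)
    perfect⇒perfectOn perfect T uniq _ with perfect (length T) (lookup T) (lookup-injective uniq)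
    ... | k , ((col , proper) , _) , ((g , g-injective , g-adjacent) , _) =
      k , asColouring col proper , largeClique (map (lookup T ∘ g) (allFin k)) members⊆ isClique large
      where
      members⊆ : map (lookup T ∘ g) (allFin k) ⊆ T
      members⊆ v∈ with ∈-map⁻ (lookup T ∘ g) v∈
      ... | i , _ , refl = ∈-lookup (g i)
      isClique : Clique asDecGraph (map (lookup T ∘ g) (allFin k))
      isClique = AllPairs.map⁺ (AllPairs.map (λ {i} {j} → g-adjacent i j) (Unique.allFin⁺ k))
      large : k ≤ length (map (lookup T ∘ g) (allFin k))
      large = ℕ.≤-reflexive (≡.sym (≡.trans (length-map (lookup T ∘ g) (allFin k))
                                            (length-tabulate {n = k} (λ i → i))))

    cover-injective : ∀ {j l} {c : Fin m → Fin j} → IsCliqueCover F j c → (g : Fin l → Fin m) →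
                      Injective _≡_ _≡_ g → (∀ a b → ¬ Adj F (g a) (g b)) → Injective _≡_ _≡_ (c ∘ g)
    cover-injective cover g g-injective independent {a} {b} e with g a Fin.≟ g b
    ... | yes ga≡gb = g-injective ga≡gb
    ... | no ga≢gb = ⊥-elim (independent a b (cover (g a) (g b) e ga≢gb))

    complement-χ=ω⇒k=α : χ=ω (complement asDecGraph) (allFin m) →
                          ∃[ k ] (IsCliqueCoverNumber F k × IsIndependenceNumber F k)
    complement-χ=ω⇒k=α (k , colouring c bounded proper , largeClique I I⊆ stable large) =
      k , ((cover , isCover) , minimal) , ((independent , g-injective , g-independent) , maximal)
      where
      cover : Fin m → Fin k
      cover v = fromℕ< (bounded (∈-allFin v))

      isCover : IsCliqueCover F k cover
      isCover u v e u≢v = decidable-stable (adj? u v) λ u≁v →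
        proper (∈-allFin u) (∈-allFin v) (u≢v , u≁v)
          (≡.trans (≡.sym (toℕ-fromℕ< _)) (≡.trans (cong toℕ e) (toℕ-fromℕ< _)))

      I-nonadjacent : ∀ {u v} → u ∈ I → v ∈ I → ¬ Adj F u v
      I-nonadjacent {u} {v} u∈ v∈ u~v with u Fin.≟ v
      ... | yes refl = irrefl F u~v
      ... | no u≢v = proj₂ (AllPairs-∈ (DecGraph.~-sym (complement asDecGraph)) stable u∈ v∈ u≢v) u~v

      I-unique : Unique I
      I-unique = Clique⇒Unique {complement asDecGraph} stable

      minimal : ∀ j (c′ : Fin m → Fin j) → IsCliqueCover F j c′ → k ≤ j
      minimal j c′ isCover′ = ℕ.≤-trans large (injective⇒≤ (cover-injective isCover′ (lookup I)
        (lookup-injective I-unique) (λ a b → I-nonadjacent (∈-lookup a) (∈-lookup b))))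

      independent : Fin k → Fin m
      independent a = lookup I (inject≤ a large)

      g-injective : Injective _≡_ _≡_ independent
      g-injective {a} {b} e = inject≤-injective large large a b (lookup-injective I-unique e)

      g-independent : ∀ a b → ¬ Adj F (independent a) (independent b)
      g-independent a b = I-nonadjacent (∈-lookup _) (∈-lookup _)

      maximal : ∀ j (g : Fin j → Fin m) → IsIndependent F j g → j ≤ k
      maximal j g (g-injective′ , g-independent′) = injective⇒≤ (cover-injective isCover g g-injective′ g-independent′)

  perfect⇒k=α : Perfect F → ∃[ k ] (IsCliqueCoverNumber F k × IsIndependenceNumber F k)
  perfect⇒k=α perfect = complement-χ=ω⇒k=α adj?
    (Lovász.perfect⇒complement-χ=ω (asDecGraph adj?) (Unique.allFin⁺ m) (perfect⇒perfectOn adj? perfect))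
    where
    adj? : ∀ u v → Dec (Adj F u v)
    adj? = perfect⇒adjacent? perfect

-- Hexagons

TwinFree : (Fin 6 → Fin 6 → Bool) → Set
TwinFree P = ∀ i j → i ≢ j → ∃[ k ] (P i k ≢ P j k)

twinFree? : ∀ P → Dec (TwinFree P)
twinFree? P = Fin.all? λ i → Fin.all? λ j → ¬? (i Fin.≟ j) →-dec Fin.any? λ k → ¬? (P i k Bool.≟ P j k)

Realises : (Fin 6 → Fin 6 → Bool) → List (ℕ × ℕ) → Set
Realises P es = ∀ i j → P i j ≡ isEdge es (toℕ i) (toℕ j)

realises? : ∀ P es → Dec (Realises P es)
realises? P es = Fin.all? λ i → Fin.all? λ j → P i j Bool.≟ isEdge es (toℕ i) (toℕ j)

reflects⇔ : ∀ {A : Set} {b} → Reflects A b → A ⇔ (b ≡ true)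
reflects⇔ (ofʸ a) = mk⇔ (λ _ → refl) (λ _ → a)
reflects⇔ (ofⁿ ¬a) = mk⇔ (⊥-elim ∘ ¬a) (λ ())

module _ {n} (G : Graph n) where

  -- Twin-freeness makes h injective: vertices with the same image would have the same row of P.
  contains-pattern : ∀ {P} es (h : Fin 6 → Fin n) → (∀ i j → Reflects (Adj G (h i) (h j)) (P i j)) →
                     True (twinFree? P) → True (realises? P es) → ContainsInduced G (fromEdges es)
  contains-pattern {P} es h reflects twinFree? realises? =
    h , injective , λ i j → reflects⇔ (≡.subst (Reflects _) (realises i j) (reflects i j))
    where
    twinFree : TwinFree P
    twinFree = toWitness twinFree?

    realises : Realises P es
    realises = toWitness realises?

    injective : Injective _≡_ _≡_ h
    injective {i} {j} hi≡hj with i Fin.≟ j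
    ... | yes i≡j = i≡j
    ... | no i≢j = let k , differ = twinFree i j i≢j in
      ⊥-elim (differ (det (reflects i k)
                          (≡.subst (λ v → Reflects (Adj G v (h k)) (P j k)) (≡.sym hi≡hj) (reflects j k))))

record Hexagon {n} (G : Graph n) : Set where
  field
    v₀ v₁ v₂ v₃ v₄ v₅ : Fin n
    v₀~v₁ : Adj G v₀ v₁
    v₁~v₂ : Adj G v₁ v₂
    v₂~v₃ : Adj G v₂ v₃
    v₃~v₄ : Adj G v₃ v₄
    v₄~v₅ : Adj G v₄ v₅
    v₅~v₀ : Adj G v₅ v₀
    v₁≁v₃ : ¬ Adj G v₁ v₃
    v₃≁v₅ : ¬ Adj G v₃ v₅
    v₅≁v₁ : ¬ Adj G v₅ v₁
    v₀≁v₃ : ¬ Adj G v₀ v₃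
    v₂≁v₅ : ¬ Adj G v₂ v₅
    v₄≁v₁ : ¬ Adj G v₄ v₁

reflects-sym : ∀ {n} (G : Graph n) {u v b} → Reflects (Adj G u v) b → Reflects (Adj G v u) b
reflects-sym G (ofʸ u~v) = ofʸ (sym G u~v)
reflects-sym G (ofⁿ u≁v) = ofⁿ (u≁v ∘ sym G)

-- C6, C6¹, C6², C6³ are this pattern with the chords none, 02, {02, 24} and {02, 24, 04}.
hexagonPattern : (b₀₂ b₂₄ b₀₄ : Bool) → Fin 6 → Fin 6 → Bool
hexagonPattern b₀₂ b₂₄ b₀₄ i j = isEdge c6Edges (toℕ i) (toℕ j) ∨ chord i j
  where
  chord : Fin 6 → Fin 6 → Bool
  chord 0F 2F = b₀₂
  chord 2F 0F = b₀₂
  chord 2F 4F = b₂₄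
  chord 4F 2F = b₂₄
  chord 0F 4F = b₀₄
  chord 4F 0F = b₀₄
  chord _  _  = false

module _ {n} {G : Graph n} (X : Hexagon G) where
  open Hexagon X

  vertex : Fin 6 → Fin n
  vertex 0F = v₀
  vertex 1F = v₁
  vertex 2F = v₂
  vertex 3F = v₃
  vertex 4F = v₄
  vertex 5F = v₅

  module _ {b₀₂ b₂₄ b₀₄} (r₀₂ : Reflects (Adj G v₀ v₂) b₀₂) (r₂₄ : Reflects (Adj G v₂ v₄) b₂₄)
           (r₀₄ : Reflects (Adj G v₀ v₄) b₀₄) where

    hexagon-reflects : ∀ i j → Reflects (Adj G (vertex i) (vertex j)) (hexagonPattern b₀₂ b₂₄ b₀₄ i j)
    hexagon-reflects 0F 0F = ofⁿ (irrefl G)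
    hexagon-reflects 0F 1F = ofʸ v₀~v₁
    hexagon-reflects 0F 2F = r₀₂
    hexagon-reflects 0F 3F = ofⁿ v₀≁v₃
    hexagon-reflects 0F 4F = r₀₄
    hexagon-reflects 0F 5F = ofʸ (sym G v₅~v₀)
    hexagon-reflects 1F 0F = ofʸ (sym G v₀~v₁)
    hexagon-reflects 1F 1F = ofⁿ (irrefl G)
    hexagon-reflects 1F 2F = ofʸ v₁~v₂
    hexagon-reflects 1F 3F = ofⁿ v₁≁v₃
    hexagon-reflects 1F 4F = ofⁿ (v₄≁v₁ ∘ sym G)
    hexagon-reflects 1F 5F = ofⁿ (v₅≁v₁ ∘ sym G)
    hexagon-reflects 2F 0F = reflects-sym G r₀₂
    hexagon-reflects 2F 1F = ofʸ (sym G v₁~v₂)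
    hexagon-reflects 2F 2F = ofⁿ (irrefl G)
    hexagon-reflects 2F 3F = ofʸ v₂~v₃
    hexagon-reflects 2F 4F = r₂₄
    hexagon-reflects 2F 5F = ofⁿ v₂≁v₅
    hexagon-reflects 3F 0F = ofⁿ (v₀≁v₃ ∘ sym G)
    hexagon-reflects 3F 1F = ofⁿ (v₁≁v₃ ∘ sym G)
    hexagon-reflects 3F 2F = ofʸ (sym G v₂~v₃)
    hexagon-reflects 3F 3F = ofⁿ (irrefl G)
    hexagon-reflects 3F 4F = ofʸ v₃~v₄
    hexagon-reflects 3F 5F = ofⁿ v₃≁v₅
    hexagon-reflects 4F 0F = reflects-sym G r₀₄
    hexagon-reflects 4F 1F = ofⁿ v₄≁v₁
    hexagon-reflects 4F 2F = reflects-sym G r₂₄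
    hexagon-reflects 4F 3F = ofʸ (sym G v₃~v₄)
    hexagon-reflects 4F 4F = ofⁿ (irrefl G)
    hexagon-reflects 4F 5F = ofʸ v₄~v₅
    hexagon-reflects 5F 0F = ofʸ v₅~v₀
    hexagon-reflects 5F 1F = ofⁿ v₅≁v₁
    hexagon-reflects 5F 2F = ofⁿ (v₂≁v₅ ∘ sym G)
    hexagon-reflects 5F 3F = ofⁿ (v₃≁v₅ ∘ sym G)
    hexagon-reflects 5F 4F = ofʸ (sym G v₄~v₅)
    hexagon-reflects 5F 5F = ofⁿ (irrefl G)

    hexagon-contains : ∀ es → let P = hexagonPattern b₀₂ b₂₄ b₀₄ in
                       True (twinFree? P) → True (realises? P es) → ContainsInduced G (fromEdges es)
    hexagon-contains es = contains-pattern G es vertex hexagon-reflects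

rotate : ∀ {n} {G : Graph n} → Hexagon G → Hexagon G
rotate X = record
  { v₀ = v₂ ; v₁ = v₃ ; v₂ = v₄ ; v₃ = v₅ ; v₄ = v₀ ; v₅ = v₁
  ; v₀~v₁ = v₂~v₃ ; v₁~v₂ = v₃~v₄ ; v₂~v₃ = v₄~v₅ ; v₃~v₄ = v₅~v₀ ; v₄~v₅ = v₀~v₁ ; v₅~v₀ = v₁~v₂
  ; v₁≁v₃ = v₃≁v₅ ; v₃≁v₅ = v₅≁v₁ ; v₅≁v₁ = v₁≁v₃
  ; v₀≁v₃ = v₂≁v₅ ; v₂≁v₅ = v₄≁v₁ ; v₄≁v₁ = v₀≁v₃
  }
  where open Hexagon X

data Canonical : Bool → Bool → Bool → Set where
  none  : Canonical false false false
  one   : Canonical true  false false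
  two   : Canonical true  true  false
  three : Canonical true  true  true

-- Rotating a hexagon by two steps permutes its three chords cyclically.
canonicalise : ∀ b₀₂ b₂₄ b₀₄ → Canonical b₀₂ b₂₄ b₀₄ ⊎ Canonical b₂₄ b₀₄ b₀₂ ⊎ Canonical b₀₄ b₀₂ b₂₄
canonicalise false false false = inj₁ none
canonicalise true  false false = inj₁ one
canonicalise false true  false = inj₂ (inj₁ one)
canonicalise false false true  = inj₂ (inj₂ one)
canonicalise true  true  false = inj₁ two
canonicalise false true  true  = inj₂ (inj₁ two)
canonicalise true  false true  = inj₂ (inj₂ two)
canonicalise true  true  true  = inj₁ three

module _ {n} (G : Graph n) where

  canonical-hexagon-free : ℋ-free G → (X : Hexagon G) → let open Hexagon X in
    ∀ {b₀₂ b₂₄ b₀₄} → Reflects (Adj G v₀ v₂) b₀₂ → Reflects (Adj G v₂ v₄) b₂₄ →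
    Reflects (Adj G v₀ v₄) b₀₄ → Canonical b₀₂ b₂₄ b₀₄ → ⊥
  canonical-hexagon-free (C6-free , _ , _ , _) X r₀₂ r₂₄ r₀₄ none =
    C6-free (hexagon-contains X r₀₂ r₂₄ r₀₄ c6Edges _ _)
  canonical-hexagon-free (_ , C6¹-free , _ , _) X r₀₂ r₂₄ r₀₄ one =
    C6¹-free (hexagon-contains X r₀₂ r₂₄ r₀₄ ((0 , 2) ∷ c6Edges) _ _)
  canonical-hexagon-free (_ , _ , C6²-free , _) X r₀₂ r₂₄ r₀₄ two =
    C6²-free (hexagon-contains X r₀₂ r₂₄ r₀₄ ((0 , 2) ∷ (2 , 4) ∷ c6Edges) _ _)
  canonical-hexagon-free (_ , _ , _ , C6³-free) X r₀₂ r₂₄ r₀₄ three =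
    C6³-free (hexagon-contains X r₀₂ r₂₄ r₀₄ ((0 , 2) ∷ (2 , 4) ∷ (0 , 4) ∷ c6Edges) _ _)

  -- Adjacency need not be decidable, but the goal is ⊥, so the chords may be decided classically.
  hexagon-free : ℋ-free G → ¬ Hexagon G
  hexagon-free free X =
    ¬¬-excluded-middle λ d₀₂ → ¬¬-excluded-middle λ d₂₄ → ¬¬-excluded-middle λ d₀₄ →
    let r₀₂ = proof d₀₂ ; r₂₄ = proof d₂₄ ; r₀₄ = proof d₀₄ in
    [ canonical-hexagon-free free X r₀₂ r₂₄ r₀₄
    , [ canonical-hexagon-free free (rotate X) r₂₄ (reflects-sym G r₀₄) (reflects-sym G r₀₂)
      , canonical-hexagon-free free (rotate (rotate X)) (reflects-sym G r₀₄) r₀₂ (reflects-sym G r₂₄) ] ]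
    (canonicalise _ _ _)

-- Cliques of H* in ℋ-free graphs

ℋ-free-induce : ∀ {n m} (G : Graph n) {f : Fin m → Fin n} → Injective _≡_ _≡_ f → ℋ-free G → ℋ-free (induce G f)
ℋ-free-induce G {f} f-injective (C6-free , C6¹-free , C6²-free , C6³-free) =
  C6-free ∘ push , C6¹-free ∘ push , C6²-free ∘ push , C6³-free ∘ push
  where
  push : ∀ {E} → ContainsInduced (induce G f) E → ContainsInduced G E
  push (g , g-injective , reflects) = f ∘ g , g-injective ∘ f-injective , reflects

dist2⇒≢ : ∀ {n} (H : Graph n) {u v} → Dist2 H u v → u ≢ v
dist2⇒≢ _ = proj₁

dist2⇒≁ : ∀ {n} (H : Graph n) {u v} → Dist2 H u v → ¬ Adj H u v
dist2⇒≁ _ = proj₁ ∘ proj₂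

triple : ∀ {m} → Fin m → Fin m → Fin m → Fin 3 → Fin m
triple x y z 0F = x
triple x y z 1F = y
triple x y z 2F = z

injective₃ : ∀ {A : Set} {f : Fin 3 → A} → f 0F ≢ f 1F → f 0F ≢ f 2F → f 1F ≢ f 2F → Injective _≡_ _≡_ f
injective₃ _ _ _ {0F} {0F} _ = refl
injective₃ _ _ _ {1F} {1F} _ = refl
injective₃ _ _ _ {2F} {2F} _ = refl
injective₃ f01 _ _ {0F} {1F} e = ⊥-elim (f01 e)
injective₃ _ f02 _ {0F} {2F} e = ⊥-elim (f02 e)
injective₃ _ _ f12 {1F} {2F} e = ⊥-elim (f12 e)
injective₃ f01 _ _ {1F} {0F} e = ⊥-elim (f01 (≡.sym e))
injective₃ _ f02 _ {2F} {0F} e = ⊥-elim (f02 (≡.sym e))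
injective₃ _ _ f12 {2F} {1F} e = ⊥-elim (f12 (≡.sym e))

module _ (H : Graph 3) where

  midpoint : Dist2 H 0F 1F → Adj H 0F 2F × Adj H 2F 1F
  midpoint (_ , _ , 0F , 0~0 , _) = ⊥-elim (irrefl H 0~0)
  midpoint (_ , _ , 1F , _ , 1~1) = ⊥-elim (irrefl H 1~1)
  midpoint (_ , _ , 2F , 0~2 , 2~1) = 0~2 , 2~1

  -- On three vertices H* has at most the edge 01, and a minimum clique cover of H* uses two
  -- classes exactly when that edge is present.
  dist2-decided-by-cover : ∀ {k} → IsCliqueCoverNumber (star H) k → Dec (Dist2 H 0F 1F)
  dist2-decided-by-cover ((c , cover) , minimal) with c 0F Fin.≟ c 1F
  ... | yes c0≡c1 = yes (cover 0F 1F c0≡c1 λ ())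
  ... | no c0≢c1 = no λ d → 3≰2 (ℕ.≤-trans (injective⇒≤ (c-injective d)) (minimal 2 pairUp (pairUp-cover d)))
    where
    3≰2 : ¬ 3 ≤ 2
    3≰2 (s≤s (s≤s ()))
    c-injective : Dist2 H 0F 1F → Injective _≡_ _≡_ c
    c-injective d = injective₃ c0≢c1
      (λ e → dist2⇒≁ H (cover 0F 2F e λ ()) (proj₁ (midpoint d)))
      (λ e → dist2⇒≁ H (cover 1F 2F e λ ()) (sym H (proj₂ (midpoint d))))
    pairUp : Fin 3 → Fin 2
    pairUp 2F = 1F
    pairUp _  = 0F
    pairUp-cover : Dist2 H 0F 1F → IsCliqueCover (star H) 2 pairUp
    pairUp-cover d 0F 1F _ _ = d
    pairUp-cover d 1F 0F _ _ = Graph.sym (star H) d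
    pairUp-cover d 0F 0F _ i≢i = ⊥-elim (i≢i refl)
    pairUp-cover d 1F 1F _ i≢i = ⊥-elim (i≢i refl)
    pairUp-cover d 2F 2F _ i≢i = ⊥-elim (i≢i refl)
    pairUp-cover d 0F 2F ()
    pairUp-cover d 1F 2F ()
    pairUp-cover d 2F 0F ()
    pairUp-cover d 2F 1F ()

cd⇒cover : ∀ {m} (H : Graph m) {k c} → IsCdColouring H k c → IsCliqueCover (star H) k c
cd⇒cover H {c = c} (proper , centred) u v cu≡cv u≢v with centred (c u)
... | w , class⊆ with class⊆ u refl | class⊆ v (≡.sym cu≡cv)
... | inj₁ u≡w | inj₁ v≡w = ⊥-elim (u≢v (≡.trans u≡w (≡.sym v≡w)))
... | inj₁ refl | inj₂ u~v = ⊥-elim (proper u v u~v cu≡cv)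
... | inj₂ v~u | inj₁ refl = ⊥-elim (proper u v (sym H v~u) cu≡cv)
... | inj₂ w~u | inj₂ w~v = u≢v , (λ u~v → proper u v u~v cu≡cv) , w , sym H w~u , w~v

-- By minimality of k there are no colours when there are no vertices.
some-vertex : ∀ {m k} (H : Graph m) → (∀ j c → IsCliqueCover (star H) j c → k ≤ j) → Fin k → Fin m
some-vertex {suc _} _ _ _ = zero
some-vertex {zero} {suc _} _ minimal _ with minimal 0 (λ ()) (λ ())
... | ()

-- Adjacency in a Graph is an arbitrary Set.  The Helly argument only has to decide whether a
-- neighbour of y sees a non-neighbour x of y, i.e. whether x and y are at distance 2 in the
-- subgraph induced on the three vertices; the hypothesis of the theorem decides that.
Dist2DecidableOnTriples : ∀ {m} → Graph m → Set
Dist2DecidableOnTriples {m} H = ∀ (t : Fin 3 → Fin m) → Injective _≡_ _≡_ t → Dec (Dist2 (induce H t) 0F 1F)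

module _ {m} (H : Graph m) (free : ℋ-free H) (dist2? : Dist2DecidableOnTriples H) where

  adjacent? : ∀ {x y z} → x ≢ y → ¬ Adj H x y → Adj H z y → Dec (Adj H z x)
  adjacent? {x} {y} {z} x≢y x≁y z~y with dist2? (triple x y z) (injective₃ x≢y x≢z z≢y′)
    where
    x≢z : x ≢ z
    x≢z refl = x≁y z~y
    z≢y′ : y ≢ z
    z≢y′ refl = irrefl H z~y
  ... | yes d = yes (sym H (proj₁ (midpoint (induce H (triple x y z)) d)))
  ... | no ¬d = no λ z~x → ¬d ((λ ()) , x≁y , 2F , sym H z~x , z~y)

  three-neighbours : ∀ {a b d} rest → Dist2 H a b → Dist2 H a d → Dist2 H b d →
                     ∀ {wa wb wd} → All (Adj H wa) (b ∷ d ∷ rest) → All (Adj H wb) (a ∷ d ∷ rest) →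
                     All (Adj H wd) (a ∷ b ∷ rest) → ∃[ w ] All (Adj H w) (a ∷ b ∷ d ∷ rest)
  three-neighbours rest a-b a-d b-d {wa} {wb} {wd}
                   wa~@(wa~b ∷ wa~d ∷ _) (wb~a ∷ wb~d ∷ wb~rest) (wd~a ∷ wd~b ∷ wd~rest)
    with adjacent? (dist2⇒≢ H a-b) (dist2⇒≁ H a-b) wa~b
  ... | yes wa~a = wa , wa~a ∷ wa~
  ... | no wa≁a with adjacent? (dist2⇒≢ H a-b ∘ ≡.sym) (dist2⇒≁ H a-b ∘ sym H) wb~a
  ...   | yes wb~b = wb , wb~a ∷ wb~b ∷ wb~d ∷ wb~rest
  ...   | no wb≁b with adjacent? (dist2⇒≢ H a-d ∘ ≡.sym) (dist2⇒≁ H a-d ∘ sym H) wd~a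
  ...     | yes wd~d = wd , wd~a ∷ wd~b ∷ wd~d ∷ wd~rest
  ...     | no wd≁d = ⊥-elim (hexagon-free H free record
    { v₀ = wb ; v₁ = _ ; v₂ = wd ; v₃ = _ ; v₄ = wa ; v₅ = _
    ; v₀~v₁ = wb~a ; v₁~v₂ = sym H wd~a ; v₂~v₃ = wd~b ; v₃~v₄ = sym H wa~b ; v₄~v₅ = wa~d ; v₅~v₀ = sym H wb~d
    ; v₁≁v₃ = dist2⇒≁ H a-b ; v₃≁v₅ = dist2⇒≁ H b-d ; v₅≁v₁ = dist2⇒≁ H a-d ∘ sym H
    ; v₀≁v₃ = wb≁b ; v₂≁v₅ = wd≁d ; v₄≁v₁ = wa≁a })

  common-neighbour : ∀ a b rest → AllPairs (Dist2 H) (a ∷ b ∷ rest) → ∃[ w ] All (Adj H w) (a ∷ b ∷ rest)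
  common-neighbour a b [] ((( _ , _ , w , a~w , w~b) ∷ []) ∷ _) = w , sym H a~w ∷ w~b ∷ []
  common-neighbour a b (d ∷ rest) ((a-b ∷ a-d ∷ a-rest) ∷ (b-d ∷ b-rest) ∷ d-rest ∷ rest-pairs) =
    three-neighbours rest a-b a-d b-d
      (proj₂ (common-neighbour b d rest ((b-d ∷ b-rest) ∷ d-rest ∷ rest-pairs)))
      (proj₂ (common-neighbour a d rest ((a-d ∷ a-rest) ∷ d-rest ∷ rest-pairs)))
      (proj₂ (common-neighbour a b rest ((a-b ∷ a-rest) ∷ b-rest ∷ rest-pairs)))

  cover⇒cd : ∀ {k c} → (∀ j c′ → IsCliqueCover (star H) j c′ → k ≤ j) →
             IsCliqueCover (star H) k c → IsCdColouring H k c
  cover⇒cd {k} {c} minimal cover = proper , centred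
    where
    proper : IsProper H k c
    proper u v u~v cu≡cv = dist2⇒≁ H (cover u v cu≡cv λ { refl → irrefl H u~v }) u~v

    centred : ∀ i → ∃[ v ] (∀ u → c u ≡ i → (u ≡ v ⊎ Adj H v u))
    centred i = centre class class-pairs λ u cu≡i → ∈-filter⁺ (λ u → c u Fin.≟ i) (∈-allFin u) cu≡i
      where
      class : List (Fin m)
      class = filter (λ u → c u Fin.≟ i) (allFin m)

      class-pairs : AllPairs (Dist2 H) class
      class-pairs = AllPairs-from-∈ (Unique.filter⁺ (λ u → c u Fin.≟ i) (Unique.allFin⁺ m)) λ u∈ v∈ →
        cover _ _ (≡.trans (proj₂ (∈-filter⁻ (λ u → c u Fin.≟ i) {xs = allFin m} u∈))
                           (≡.sym (proj₂ (∈-filter⁻ (λ u → c u Fin.≟ i) {xs = allFin m} v∈))))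

      centre : ∀ L → AllPairs (Dist2 H) L → (∀ u → c u ≡ i → u ∈ L) →
               ∃[ v ] (∀ u → c u ≡ i → (u ≡ v ⊎ Adj H v u))
      centre [] _ class⊆ = some-vertex H minimal i , λ u cu≡i → ⊥-elim (∉[] (class⊆ u cu≡i))
        where
        ∉[] : ∀ {u} → ¬ u ∈ []
        ∉[] ()
      centre (a ∷ []) _ class⊆ = a , λ u cu≡i → inj₁ (only (class⊆ u cu≡i))
        where
        only : ∀ {u} → u ∈ a ∷ [] → u ≡ a
        only (here u≡a) = u≡a
      centre (a ∷ b ∷ rest) pairs class⊆ =
        let w , w~ = common-neighbour a b rest pairs in
        w , λ u cu≡i → inj₂ (All.lookup w~ (class⊆ u cu≡i))

module _ {n} (G : Graph n) (free : ℋ-free G)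
         (k=α : ∀ m (f : Fin m → Fin n) → Injective _≡_ _≡_ f →
                ∃[ k ] (IsCliqueCoverNumber (star (induce G f)) k × IsIndependenceNumber (star (induce G f)) k)) where

  dist2-decidable : ∀ {m} (f : Fin m → Fin n) → Injective _≡_ _≡_ f → Dist2DecidableOnTriples (induce G f)
  dist2-decidable f f-injective t t-injective =
    dist2-decided-by-cover (induce G (f ∘ t)) (proj₁ (proj₂ (k=α 3 (f ∘ t) (t-injective ∘ f-injective))))

  cd-perfect : CdPerfect G
  cd-perfect m f f-injective with k=α m f f-injective
  ... | k , ((c , cover) , minimal) , independence =
    k , ((c , cover⇒cd (induce G f) (ℋ-free-induce G f-injective free) (dist2-decidable f f-injective) minimal cover) ,
         λ j c′ cd → minimal j c′ (cd⇒cover (induce G f) cd)) ,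
    independence

corollary2 :
    (∀ n (G : Graph n) → ℋ-free G →
      (∀ m (f : Fin m → Fin n) → Injective _≡_ _≡_ f →
        ∃[ k ] (IsCliqueCoverNumber (star (induce G f)) k × IsIndependenceNumber (star (induce G f)) k)) →
      CdPerfect G)
    ×
    (∀ n (G : Graph n) → ℋ-free G →
      (∀ m (f : Fin m → Fin n) → Injective _≡_ _≡_ f → Perfect (star (induce G f))) →
      CdPerfect G)
corollary2 =
  (λ _ G free k=α → cd-perfect G free k=α) ,
  (λ _ G free perfect → cd-perfect G free λ m f f-injective →
                           perfect⇒k=α (star (induce G f)) (perfect m f f-injective))
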